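{- Let $n$ be a positive integer and let $q$ be a positive odd integer belonging to one of the intervals $I_1=[1,2n/21]$, $I_2=(n/10,2n/15]$ or $I_3=(n/6,2n/9]$. Then the interval $[n+1,4n/3]$ contains an odd multiple of $2q$, i.e. an integer of the form $2mq$ with $m$ odd. -}

module Defs where

open import Data.Nat using (ℕ; _+_; _*_; _≤_; _<_)
open import Data.Nat.Divisibility using (_∣_)
open import Data.Sum using (_⊎_)
open import Data.Product using (_×_)
open import Relation.Nullary using (¬_)

Odd : ℕ → Set
Odd k = ¬ (2 ∣ k)

InIntervals : ℕ → ℕ → Set
InIntervals n q =
  (1 ≤ q × 21 * q ≤ 2 * n)
  ⊎ (n < 10 * q × 15 * q ≤ 2 * n)
  ⊎ (n < 6 * q × 9 * q ≤ 2 * n)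

-- The odd multiples of 2q are exactly the numbers congruent to 2q modulo 4q, so every
-- window (n, n + 4q] contains one, and for 12q ≤ n that window lies inside (n, 4n/3].
-- For n < 12q the intervals I₁, I₂, I₃ are chosen so that 2·7q, 2·5q resp. 2·3q itself
-- lies in (n, 4n/3].
module Submission where

open import Defs
open import Data.Nat using (ℕ; NonZero; suc; _+_; _*_; _≤_; _<_; _≤?_; _<?_; >-nonZero)
open import Data.Nat.Properties
open import Algebra.Properties.CommutativeSemigroup +-commutativeSemigroup using (x∙yz≈xz∙y)
open import Data.Nat.DivMod using (_/_; _%_; m≡m%n+[m/n]*n; m%n<n)
open import Data.Nat.Divisibility using (m∣m*n; ∣m+n∣m⇒∣n; ∣1⇒≡1)
open import Data.Nat.Tactic.RingSolver using (solve-∀)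
open import Data.Product using (_×_; ∃-syntax; _,_)
open import Data.Sum using (inj₁; inj₂)
open import Relation.Nullary using (yes; no)
open import Relation.Binary.PropositionalEquality using (_≡_; subst; sym; cong)

2*n+1-odd : ∀ n → Odd (2 * n + 1)
2*n+1-odd n 2∣2n+1 with ∣1⇒≡1 (∣m+n∣m⇒∣n 2∣2n+1 (m∣m*n n))
... | ()

<⇒+1≤ : ∀ {m n} → m < n → m + 1 ≤ n
<⇒+1≤ {m} {n} m<n = subst (_≤ n) (+-comm 1 m) m<n

residue-in-window-of-remainder : ∀ r k a d → r < d → a ≤ d →
  ∃[ j ] (r + k * d < a + j * d × a + j * d ≤ r + k * d + d)
residue-in-window-of-remainder r k a d r<d a≤d with r <? a
... | yes r<a = k , +-monoˡ-< K r<a , (begin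
    a + K        ≤⟨ +-monoˡ-≤ K a≤d ⟩
    d + K        ≤⟨ m≤n+m (d + K) r ⟩
    r + (d + K)  ≡⟨ x∙yz≈xz∙y r d K ⟩
    r + K + d    ∎)
  where
  open ≤-Reasoning
  K = k * d
... | no r≮a = suc k , (begin-strict
    r + K        <⟨ +-monoˡ-< K r<d ⟩
    d + K        ≤⟨ m≤n+m (d + K) a ⟩
    a + (d + K)  ∎) , (begin
    a + (d + K)  ≤⟨ +-monoˡ-≤ (d + K) (≮⇒≥ r≮a) ⟩
    r + (d + K)  ≡⟨ x∙yz≈xz∙y r d K ⟩
    r + K + d    ∎)
  where
  open ≤-Reasoning
  K = k * d

residue-in-window : ∀ n a d .{{_ : NonZero d}} → a ≤ d →
                    ∃[ j ] (n < a + j * d × a + j * d ≤ n + d)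
residue-in-window n a d a≤d =
  subst (λ x → ∃[ j ] (x < a + j * d × a + j * d ≤ x + d))
        (sym (m≡m%n+[m/n]*n n d))
        (residue-in-window-of-remainder (n % d) (n / d) a d (m%n<n n d) a≤d)

odd-multiple-in-window : ∀ n q .{{_ : NonZero q}} →
                         ∃[ m ] (Odd m × n < 2 * m * q × 2 * m * q ≤ n + 4 * q)
odd-multiple-in-window n q
  with j , lower , upper ← residue-in-window n (2 * q) (4 * q) {{m*n≢0 4 q}} (*-monoˡ-≤ q (m≤n+m 2 2))
  = 2 * j + 1 , 2*n+1-odd j
  , subst (n <_) (sym (expand j q)) lower
  , subst (_≤ n + 4 * q) (sym (expand j q)) upper
  where
  expand : ∀ j q → 2 * (2 * j + 1) * q ≡ 2 * q + j * (4 * q)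
  expand = solve-∀

odd-multiple-when-12q≤n : ∀ n q .{{_ : NonZero q}} → 12 * q ≤ n →
  ∃[ m ] (Odd m × n + 1 ≤ 2 * m * q × 3 * (2 * m * q) ≤ 4 * n)
odd-multiple-when-12q≤n n q 12q≤n
  with m , odd , lower , upper ← odd-multiple-in-window n q
  = m , odd , <⇒+1≤ lower , (begin
    3 * (2 * m * q)      ≤⟨ *-monoʳ-≤ 3 upper ⟩
    3 * (n + 4 * q)      ≡⟨ *-distribˡ-+ 3 n (4 * q) ⟩
    3 * n + 3 * (4 * q)  ≡⟨ cong (3 * n +_) (sym (*-assoc 3 4 q)) ⟩
    3 * n + 12 * q       ≤⟨ +-monoʳ-≤ (3 * n) 12q≤n ⟩
    3 * n + n            ≡⟨ +-comm (3 * n) n ⟩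
    4 * n                ∎)
  where open ≤-Reasoning

odd-multiple-of-witness : ∀ {n q} m → Odd m → n < 2 * m * q → 3 * m * q ≤ 2 * n →
  ∃[ m ] (Odd m × n + 1 ≤ 2 * m * q × 3 * (2 * m * q) ≤ 4 * n)
odd-multiple-of-witness {n} {q} m odd lower upper = m , odd , <⇒+1≤ lower , (begin
  3 * (2 * m * q)  ≡⟨ swap-factors m q ⟩
  2 * (3 * m * q)  ≤⟨ *-monoʳ-≤ 2 upper ⟩
  2 * (2 * n)      ≡⟨ *-assoc 2 2 n ⟨
  4 * n            ∎)
  where
  open ≤-Reasoning
  swap-factors : ∀ m q → 3 * (2 * m * q) ≡ 2 * (3 * m * q)
  swap-factors = solve-∀

lemma2 : (n q : ℕ) → 1 ≤ n → 1 ≤ q → Odd q → InIntervals n q →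
    ∃[ m ] (Odd m × n + 1 ≤ 2 * m * q × 3 * (2 * m * q) ≤ 4 * n)
lemma2 n q _ 1≤q _ (inj₁ (_ , 21q≤2n)) with 12 * q ≤? n
... | yes 12q≤n = odd-multiple-when-12q≤n n q {{>-nonZero 1≤q}} 12q≤n
... | no 12q≰n  = odd-multiple-of-witness 7 (2*n+1-odd 3)
                    (<-≤-trans (≰⇒> 12q≰n) (*-monoˡ-≤ q (m≤n+m 12 2))) 21q≤2n
lemma2 n q _ _ _ (inj₂ (inj₁ (n<10q , 15q≤2n))) = odd-multiple-of-witness 5 (2*n+1-odd 2) n<10q 15q≤2n
lemma2 n q _ _ _ (inj₂ (inj₂ (n<6q , 9q≤2n)))   = odd-multiple-of-witness 3 (2*n+1-odd 1) n<6q 9q≤2n
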